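{- For every finite graph $G$ on $n$ vertices and every integer $1\le k\le n$, $\operatorname{dmg}_k(G)\leq \min_{S\in S_k} \{n-|N[S]|\}$.
   Context: $S_k$ is the collection of $k$-vertex subsets $S\subseteq V(G)$ whose vertices have the $k$ largest degrees of $G$; $N[S]$ is the closed neighborhood of $S$. Cops and Robbers on a finite simple graph: in round $0$ each of $k$ cops and then the robber choose a vertex; in each later round each cop stays or moves along an edge, then the robber does the same; capture occurs when a cop occupies the robber's vertex. A vertex is damaged if the robber occupies it in a round in which capture does not occur; $\operatorname{dmg}_k(G)$ is the minimum number of damaged vertices over games with $k$ cops when the robber places and plays to maximize damage. -}

module Defs where

open import Data.Nat using (ℕ; zero; suc; _≤_)
open import Data.Bool using (Bool; true; false; _∧_; _∨_; T)
open import Data.Fin using (Fin; _≟_)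
open import Data.Fin.Subset using (Subset; _∈_; _∉_; ∣_∣)
open import Data.Vec using (tabulate; lookup)
open import Data.List using (List; []; _∷_; allFin)
open import Data.Bool.ListAction using (any)
open import Data.Product using (Σ; _×_; _,_; proj₁; proj₂; ∃)
open import Data.Sum using (_⊎_)
open import Relation.Nullary using (¬_)
open import Relation.Nullary.Decidable using (⌊_⌋)
open import Relation.Binary.PropositionalEquality using (_≡_)

record Graph (n : ℕ) : Set where
  field
    adj    : Fin n → Fin n → Bool
    sym    : ∀ u v → adj u v ≡ adj v u
    irrefl : ∀ v → adj v v ≡ false
open Graph public

module _ {n : ℕ} (G : Graph n) where

  Adj : Fin n → Fin n → Set
  Adj u v = T (adj G u v)

  nbhd : Fin n → Subset n
  nbhd v = tabulate (adj G v)

  degree : Fin n → ℕ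
  degree v = ∣ nbhd v ∣

  closedNbhd : Subset n → Subset n
  closedNbhd S = tabulate λ v →
    any (λ u → lookup S u ∧ (⌊ u ≟ v ⌋ ∨ adj G u v)) (allFin n)

  InSk : ℕ → Subset n → Set
  InSk k S = ∣ S ∣ ≡ k × (∀ u v → u ∈ S → v ∉ S → degree v ≤ degree u)

  Step : Fin n → Fin n → Set
  Step x y = x ≡ y ⊎ Adj x y

  State : ℕ → Set
  State k = (Fin k → Fin n) × Fin n

  -- A (deterministic, full-information) cop strategy: initial placement,
  -- and for every later round the new cop positions as a function of the
  -- current cop positions c, current robber position r and the earlier
  -- history h (most recent first).
  record CopStrategy (k : ℕ) : Set where
    field
      start : Fin k → Fin n
      next  : (Fin k → Fin n) → Fin n → List (State k) → (Fin k → Fin n)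
      legal : ∀ c r h i → Step (c i) (next c r h i)
  open CopStrategy public

  -- A robber play: its position at the end of each round (round 0 =
  -- placement); each later move stays or follows an edge.  (Against a fixed
  -- deterministic cop strategy, quantifying over all such sequences is the
  -- same as quantifying over all robber strategies.)
  RobberLegal : (ℕ → Fin n) → Set
  RobberLegal r = ∀ t → Step (r t) (r (suc t))

  module _ {k : ℕ} (σ : CopStrategy k) (r : ℕ → Fin n) where

    play : ℕ → (Fin k → Fin n) × List (State k)
    play zero    = start σ , []
    play (suc t) = next σ (proj₁ (play t)) (r t) (proj₂ (play t))
                 , ((proj₁ (play t) , r t) ∷ proj₂ (play t))

    cops : ℕ → Fin k → Fin n
    cops t = proj₁ (play t)

    -- capture occurs in round t: either a cop moves onto the robber
    -- (t = s+1, a cop at the robber's round-s vertex after the cops' move),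
    -- or the robber ends round t on a cop's vertex.
    CaughtIn : ℕ → Set
    CaughtIn zero    = ∃ λ i → cops zero i ≡ r zero
    CaughtIn (suc s) = (∃ λ i → cops (suc s) i ≡ r s)
                     ⊎ (∃ λ i → cops (suc s) i ≡ r (suc s))

    Damaged : Fin n → Set
    Damaged v = ∃ λ t → r t ≡ v × (∀ s → s ≤ suc t → ¬ CaughtIn s)

  DmgAtMost : ℕ → ℕ → Set
  DmgAtMost k m =
    Σ (CopStrategy k) λ σ → ∀ (r : ℕ → Fin n) → RobberLegal r →
      ∀ (D : Subset n) → (∀ v → v ∈ D → Damaged σ r v) → ∣ D ∣ ≤ m

module Submission where

-- Place one cop on each vertex of S and let every cop stay put until the robber
-- ends a round next to it, then jump onto the robber. Until capture the cops
-- never leave S, so a robber ending a round in N[S] is captured in that round or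
-- the next and does no damage there; hence only the n − |N[S]| vertices outside
-- N[S] can be damaged.

open import Defs hiding (sym)
open import Data.Nat using (ℕ; zero; suc; _≤_; _∸_)
open import Data.Nat.Properties using (≤-refl; ≤-trans; ≤-reflexive; n≤1+n; m≤n⇒m≤1+n)
open import Data.Bool using (true; false; if_then_else_; T)
open import Data.Bool.Properties using (T-≡; T-∧; T-∨)
open import Data.Fin using (Fin; zero; suc)
open import Data.Fin.Subset using (Subset; _∈_; _∉_; _⊆_; ∁; ∣_∣)
open import Data.Fin.Subset.Properties using (p⊆q⇒∣p∣≤∣q∣; ∣∁p∣≡n∸∣p∣; x∉p⇒x∈∁p)
open import Data.Vec using (_∷_; []; here; there)
open import Data.Vec.Properties using (lookup∘tabulate; []=⇒lookup; lookup⇒[]=)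
open import Data.List using (allFin)
open import Data.List.Relation.Unary.Any using (satisfied)
open import Data.List.Relation.Unary.Any.Properties using (any⁻)
open import Data.Empty using (⊥-elim)
open import Data.Product using (_×_; _,_; ∃)
open import Data.Sum using (_⊎_; inj₁; inj₂)
open import Function.Bundles using (Equivalence)
open import Relation.Nullary using (¬_)
open import Relation.Nullary.Decidable using (toWitness)
open import Relation.Binary.PropositionalEquality using (_≡_; refl; sym; trans; cong; subst)

open Equivalence using (to; from)

enumerate : ∀ {n} (p : Subset n) →
            ∃ λ (f : Fin ∣ p ∣ → Fin n) → ∀ {u} → u ∈ p → ∃ λ i → f i ≡ u
enumerate [] = (λ ()) , λ ()
enumerate (true ∷ p) with enumerate p
... | f , onto = g , onto′
  where
  g : Fin (suc ∣ p ∣) → Fin _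
  g zero    = zero
  g (suc i) = suc (f i)
  onto′ : ∀ {u} → u ∈ true ∷ p → ∃ λ i → g i ≡ u
  onto′ here        = zero , refl
  onto′ (there u∈p) with onto u∈p
  ... | i , fi≡u = suc i , cong suc fi≡u
enumerate (false ∷ p) with enumerate p
... | f , onto = (λ i → suc (f i)) , onto′
  where
  onto′ : ∀ {u} → u ∈ false ∷ p → ∃ λ i → suc (f i) ≡ u
  onto′ (there u∈p) with onto u∈p
  ... | i , fi≡u = i , cong suc fi≡u

module _ {n : ℕ} (G : Graph n) where

  closedNbhd-witness : ∀ {S v} → v ∈ closedNbhd G S → ∃ λ u → u ∈ S × Step G u v
  closedNbhd-witness {S} {v} v∈N[S]
    with satisfied (any⁻ _ (allFin n) (from T-≡ (trans (sym (lookup∘tabulate _ v)) ([]=⇒lookup v∈N[S]))))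
  ... | u , cond with to T-∧ cond
  ...   | u∈S , near = u , lookup⇒[]= u S (to T-≡ u∈S) , step (to T-∨ near)
    where
    step : T _ ⊎ Adj G u v → Step G u v
    step (inj₁ u≡v) = inj₁ (toWitness u≡v)
    step (inj₂ adj) = inj₂ adj

  pounce : Fin n → Fin n → Fin n
  pounce c x = if adj G c x then x else c

  pounce-legal : ∀ c x → Step G c (pounce c x)
  pounce-legal c x with adj G c x in eq
  ... | true  = inj₂ (subst T (sym eq) _)
  ... | false = inj₁ refl

  pounce-adj : ∀ {c x} → Adj G c x → pounce c x ≡ x
  pounce-adj {c} {x} a with adj G c x
  ... | true = refl

  pounce-stays-or-captures : ∀ c x → pounce c x ≡ c ⊎ pounce c x ≡ x
  pounce-stays-or-captures c x with adj G c x
  ... | true  = inj₂ refl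
  ... | false = inj₁ refl

  guard : ∀ {k} → (Fin k → Fin n) → CopStrategy G k
  guard post = record
    { start = post
    ; next  = λ c r _ i → pounce (c i) r
    ; legal = λ c r _ i → pounce-legal (c i) r
    }

  module _ {k : ℕ} (post : Fin k → Fin n) (r : ℕ → Fin n) where

    private
      cops′ : ℕ → Fin k → Fin n
      cops′ = cops G (guard post) r

      Uncaught : ℕ → Set
      Uncaught t = ∀ s → s ≤ t → ¬ CaughtIn G (guard post) r s

      earlier : ∀ {t} → Uncaught (suc t) → Uncaught t
      earlier uncaught s s≤t = uncaught s (m≤n⇒m≤1+n s≤t)

    guard-stays : ∀ t i → ¬ CaughtIn G (guard post) r (suc t) → cops′ (suc t) i ≡ cops′ t i
    guard-stays t i uncaught with pounce-stays-or-captures (cops′ t i) (r t)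
    ... | inj₁ stays    = stays
    ... | inj₂ captures = ⊥-elim (uncaught (inj₁ (i , captures)))

    guard-at-post : ∀ t i → Uncaught t → cops′ t i ≡ post i
    guard-at-post zero    i _        = refl
    guard-at-post (suc t) i uncaught =
      trans (guard-stays t i (uncaught (suc t) ≤-refl)) (guard-at-post t i (earlier uncaught))

    caught-on-cop : ∀ t i → cops′ t i ≡ r t → CaughtIn G (guard post) r t
    caught-on-cop zero    i on = i , on
    caught-on-cop (suc t) i on = inj₂ (i , on)

    guarded-undamaged : ∀ i {v} → Step G (post i) v → ¬ Damaged G (guard post) r v
    guarded-undamaged i (inj₁ post≡v) (t , rt≡v , uncaught) =
      uncaught t (n≤1+n t)
        (caught-on-cop t i (trans (guard-at-post t i (earlier uncaught)) (trans post≡v (sym rt≡v))))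
    guarded-undamaged i (inj₂ adj) (t , refl , uncaught) =
      uncaught (suc t) ≤-refl
        (inj₁ (i , trans (cong (λ c → pounce c (r t)) (guard-at-post t i (earlier uncaught))) (pounce-adj adj)))

  guard-damaged-outside : ∀ {k} (post : Fin k → Fin n) (r : ℕ → Fin n) {S v} →
                          (∀ {u} → u ∈ S → ∃ λ i → post i ≡ u) →
                          Damaged G (guard post) r v → v ∉ closedNbhd G S
  guard-damaged-outside post r covers damaged v∈N[S] with closedNbhd-witness v∈N[S]
  ... | u , u∈S , near with covers u∈S
  ...   | i , refl = guarded-undamaged post r i near damaged

  guard-dmg-bound : ∀ {k} (post : Fin k → Fin n) (S : Subset n) →
                    (∀ {u} → u ∈ S → ∃ λ i → post i ≡ u) →
                    DmgAtMost G k (n ∸ ∣ closedNbhd G S ∣)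
  guard-dmg-bound post S covers = guard post , bound
    where
    bound : ∀ r → RobberLegal G r → ∀ D → (∀ v → v ∈ D → Damaged G (guard post) r v) →
            ∣ D ∣ ≤ n ∸ ∣ closedNbhd G S ∣
    bound r _ D damaged = ≤-trans (p⊆q⇒∣p∣≤∣q∣ D⊆∁N[S]) (≤-reflexive (∣∁p∣≡n∸∣p∣ (closedNbhd G S)))
      where
      D⊆∁N[S] : D ⊆ ∁ (closedNbhd G S)
      D⊆∁N[S] {v} v∈D = x∉p⇒x∈∁p (guard-damaged-outside post r covers (damaged v v∈D))

proposition4p5 : ∀ {n : ℕ} (G : Graph n) (k : ℕ) → 1 ≤ k → k ≤ n →
                   ∀ (S : Subset n) → InSk G k S →
                   DmgAtMost G k (n ∸ ∣ closedNbhd G S ∣)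
proposition4p5 G k _ _ S (∣S∣≡k , _) with enumerate S
... | post , covers = subst (λ k → DmgAtMost G k _) ∣S∣≡k (guard-dmg-bound G post S covers)
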